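{- Let $q=p^t$, $n\ge1$. For every $\xi=(s_0,\dots,s_{t-1})\in\mathcal{H}$, the number of basis monomials in $\mathcal{M}$ of type $\xi$ equals $\prod_{j=0}^{t-1}d_{\lambda_j}$, where $\lambda_j=ps_{j+1}-s_j$ (indices mod $t$).
   Context: $\mathcal{M}$ is the set of functions $x_0^{b_0}\cdots x_n^{b_n}$ on the set of $1$-dimensional subspaces of $\mathbb{F}_q^{n+1}$ with $0\le b_i\le q-1$, $\sum_ib_i\equiv0\pmod{q-1}$ and $(b_0,\dots,b_n)\ne(q-1,\dots,q-1)$. For a nonconstant such monomial write $b_i=\sum_{j=0}^{t-1}a_{i,j}p^j$ with $0\le a_{i,j}\le p-1$ and define $s_j=\frac1{q-1}\sum_{i=0}^n\big(\sum_{\ell=0}^{j-1}p^{\ell+t-j}a_{i,\ell}+\sum_{\ell=j}^{t-1}p^{\ell-j}a_{i,\ell}\big)$; its type is $(s_0,\dots,s_{t-1})$, which lies in $\mathcal{H}$ and satisfies $\sum_i a_{i,j}=ps_{j+1}-s_j$. $\mathcal{H}$ is the set of integer $t$-tuples $(s_0,\dots,s_{t-1})$ with $1\le s_j\le n$ and $0\le ps_{j+1}-s_j\le(p-1)(n+1)$ for all $j$ (indices mod $t$). $d_i$ is the coefficient of $x^i$ in $(1+x+\cdots+x^{p-1})^{n+1}$. -}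

module Defs where

open import Data.Nat using (ℕ; zero; suc; _+_; _*_; _∸_; _^_; _≤_; _<_; _≟_; NonZero)
open import Data.Nat.Properties using (m^n≢0)
open import Data.Nat.DivMod using (_/_; _%_; m%n<n)
open import Data.Nat.Divisibility using (_∣_; _∣?_)
open import Data.Fin using (Fin; toℕ; fromℕ<)
open import Data.Fin.Properties using (all?)
open import Data.List using (List; []; _∷_; map; concatMap; upTo; length; filter; allFin)
open import Data.Nat.ListAction using (sum; product)
import Data.List as L
open import Data.Vec using (Vec; replicate) renaming ([] to []ᵥ; _∷_ to _∷ᵥ_)
import Data.Vec as V
open import Data.Vec.Properties using (≡-dec)
open import Data.Product using (_×_)
open import Relation.Nullary using (¬_; Dec; ¬?)
open import Relation.Nullary.Decidable using (_×-dec_)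
open import Relation.Binary.PropositionalEquality using (_≡_; _≢_)

qOf : ℕ → ℕ → ℕ
qOf p t = p ^ t

cyc : ∀ {t} → Fin t → Fin t
cyc {suc t} j = fromℕ< (m%n<n (suc (toℕ j)) (suc t))

digit : (p x ℓ : ℕ) → ℕ
digit zero    x ℓ = 0
digit (suc p) x ℓ = (_/_ x (suc p ^ ℓ) {{m^n≢0 (suc p) ℓ}}) % suc p

rotTerm : (p t j x : ℕ) → ℕ
rotTerm p t j x =
  sum (map (λ ℓ → p ^ (ℓ + t ∸ j) * digit p x ℓ) (upTo j))
  + sum (map (λ ℓ → p ^ (ℓ ∸ j) * digit p x ℓ) (map (j +_) (upTo (t ∸ j))))

typeNum : ∀ {m} (p t j : ℕ) → Vec ℕ m → ℕ
typeNum p t j b = V.sum (V.map (rotTerm p t j) b)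

HasType : ∀ {m} (p t : ℕ) → Vec ℕ m → (Fin t → ℕ) → Set
HasType p t b s = ∀ j → s j * (qOf p t ∸ 1) ≡ typeNum p t (toℕ j) b

-- b ∈ 𝓜 and b is nonconstant (b ≠ 0); entries < q are guaranteed by the enumeration
InMnc : ∀ {m} (p t : ℕ) → Vec ℕ m → Set
InMnc {m} p t b =
  ((qOf p t ∸ 1) ∣ V.sum b)
  × (b ≢ replicate m (qOf p t ∸ 1))
  × (b ≢ replicate m 0)

allVecs : (k m : ℕ) → List (Vec ℕ m)
allVecs k zero    = []ᵥ ∷ []
allVecs k (suc m) = concatMap (λ x → map (x ∷ᵥ_) (allVecs k m)) (upTo k)

dec-InMnc-type : ∀ {m} (p t : ℕ) (s : Fin t → ℕ) (b : Vec ℕ m) → Dec (InMnc p t b × HasType p t b s)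
dec-InMnc-type {m} p t s b =
  (((qOf p t ∸ 1) ∣? V.sum b)
   ×-dec (¬? (≡-dec _≟_ b (replicate m (qOf p t ∸ 1))))
   ×-dec (¬? (≡-dec _≟_ b (replicate m 0))))
  ×-dec all? (λ j → s j * (qOf p t ∸ 1) ≟ typeNum p t (toℕ j) b)

-- number of nonconstant monomials x_0^{b_0}⋯x_n^{b_n} in 𝓜 of type s
countType : (p t n : ℕ) → (Fin t → ℕ) → ℕ
countType p t n s = length (filter (dec-InMnc-type p t s) (allVecs (qOf p t) (suc n)))

InH : (p t n : ℕ) → (Fin t → ℕ) → Set
InH p t n s = ∀ j →
  (1 ≤ s j) × (s j ≤ n) × (s j ≤ p * s (cyc j))
  × (p * s (cyc j) ∸ s j ≤ (p ∸ 1) * suc n)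

-- polynomials as coefficient lists (constant term first)
polyAdd : List ℕ → List ℕ → List ℕ
polyAdd [] ys = ys
polyAdd (x ∷ xs) [] = x ∷ xs
polyAdd (x ∷ xs) (y ∷ ys) = (x + y) ∷ polyAdd xs ys

polyMul : List ℕ → List ℕ → List ℕ
polyMul [] ys = []
polyMul (x ∷ xs) ys = polyAdd (map (x *_) ys) (0 ∷ polyMul xs ys)

polyPow : List ℕ → ℕ → List ℕ
polyPow f zero = 1 ∷ []
polyPow f (suc k) = polyMul f (polyPow f k)

coeff : List ℕ → ℕ → ℕ
coeff [] i = 0
coeff (x ∷ xs) zero = x
coeff (x ∷ xs) (suc i) = coeff xs i

dCoeff : (p n i : ℕ) → ℕ
dCoeff p n i = coeff (polyPow (L.replicate p 1) (suc n)) i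

lam : (p t : ℕ) → (Fin t → ℕ) → Fin t → ℕ
lam p t s j = p * s (cyc j) ∸ s j

prodD : (p t n : ℕ) → (Fin t → ℕ) → ℕ
prodD p t n s = product (map (λ j → dCoeff p n (lam p t s j)) (allFin t))

{-# OPTIONS --safe #-}
-- Write bᵢ = Σⱼ aᵢⱼ pʲ and let Tⱼ = (q − 1)sⱼ be the numerators defining the type; Tⱼ sums the
-- digit strings of the bᵢ rotated by j places, read in base p.  Rotating once more gives
-- p·Tⱼ₊₁ = Tⱼ + (q − 1)·Σᵢ aᵢⱼ, so b has type s exactly when its digit column sums Σᵢ aᵢⱼ are
-- λⱼ = p sⱼ₊₁ − sⱼ: one direction cancels q − 1, the other uses that for p ≥ 2 the cyclic
-- recurrence p·Zⱼ₊₁ = Zⱼ + Kⱼ has at most one solution.  As T₀ = Σᵢ bᵢ = (q − 1)s₀, the bounds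
-- 1 ≤ s₀ ≤ n of 𝓗 make b neither 0 nor (q − 1, …, q − 1).  Finally the digit columns of b are
-- independent, and the number of ways to make column j sum to λⱼ with n + 1 digits is d_{λⱼ}.
module Submission where

open import Defs
open import Data.Empty using (⊥-elim)
open import Data.Fin using (Fin; toℕ; fromℕ<) renaming (zero to fzero; suc to fsuc)
open import Data.Fin.Properties using (all?; ¬∀⟶∃¬; fromℕ<-cong; fromℕ<-toℕ; toℕ-fromℕ<; toℕ<n)
open import Data.List using (List; []; _∷_; map; concatMap; upTo; applyUpTo; length; filter; tabulate; allFin)
import Data.List as L
open import Data.List.Properties
  using (map-upTo; map-tabulate; map-∘; map-cong; map-id; length-++; filter-++; filter-≐; filter-accept; filter-reject; filter-none)
open import Data.List.Relation.Unary.All using (All; []; _∷_; universal)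
import Data.List.Relation.Unary.All as All
open import Data.List.Relation.Unary.All.Properties using (map⁺; concat⁺; all-upTo)
open import Data.Nat
open import Data.Nat.Properties
open import Data.Nat.DivMod
open import Data.Nat.Divisibility using (divides; n∣m*n)
open import Data.Nat.ListAction using (sum; product)
open import Data.Nat.Primality using (Prime; prime)
open import Data.Nat.Solver using (module +-*-Solver)
open import Data.Product using (_×_; _,_; proj₁; proj₂)
open import Data.Sum using (inj₁; inj₂)
open import Data.Vec using (Vec; replicate) renaming ([] to []ᵥ; _∷_ to _∷ᵥ_)
import Data.Vec as V
import Data.Vec.Properties as Vecₚ
import Data.Vec.Relation.Unary.All as Allᵥ
open import Function using (_∘_; _⇔_; mk⇔; Equivalence)
open import Level using (Level)
open import Relation.Binary.PropositionalEquality
open import Relation.Nullary using (¬_; yes; no)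
open import Relation.Unary using (Pred; Decidable)
open +-*-Solver using (solve; _:=_; _:+_; _:*_; con)

∑ : ℕ → (ℕ → ℕ) → ℕ
∑ zero    f = 0
∑ (suc n) f = f 0 + ∑ n (f ∘ suc)

infix 5 ∑
syntax ∑ n (λ i → e) = ∑[ i < n ] e

∑-cong : ∀ n {f g : ℕ → ℕ} → (∀ i → i < n → f i ≡ g i) → ∑ n f ≡ ∑ n g
∑-cong zero    eq = refl
∑-cong (suc n) eq = cong₂ _+_ (eq 0 z<s) (∑-cong n (λ i i<n → eq (suc i) (s<s i<n)))

∑-0 : ∀ n → (∑[ i < n ] 0) ≡ 0
∑-0 zero    = refl
∑-0 (suc n) = ∑-0 n

∑-+ : ∀ m n f → ∑ (m + n) f ≡ ∑ m f + (∑[ i < n ] f (m + i))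
∑-+ zero    n f = refl
∑-+ (suc m) n f = trans (cong (f 0 +_) (∑-+ m n (f ∘ suc))) (sym (+-assoc (f 0) _ _))

∑-last : ∀ n f → ∑ (suc n) f ≡ ∑ n f + f n
∑-last zero    f = +-comm (f 0) 0
∑-last (suc n) f = trans (cong (f 0 +_) (∑-last n (f ∘ suc))) (sym (+-assoc (f 0) _ _))

*-distribˡ-∑ : ∀ c n f → c * ∑ n f ≡ (∑[ i < n ] c * f i)
*-distribˡ-∑ c zero    f = *-zeroʳ c
*-distribˡ-∑ c (suc n) f = trans (*-distribˡ-+ c (f 0) _) (cong (c * f 0 +_) (*-distribˡ-∑ c n (f ∘ suc)))

*-distribʳ-∑ : ∀ c n f → ∑ n f * c ≡ (∑[ i < n ] f i * c)
*-distribʳ-∑ c zero    f = refl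
*-distribʳ-∑ c (suc n) f = trans (*-distribʳ-+ c (f 0) _) (cong (f 0 * c +_) (*-distribʳ-∑ c n (f ∘ suc)))

∑-blocks : ∀ c M f → ∑ (c * M) f ≡ (∑[ y < M ] ∑[ a < c ] f (y * c + a))
∑-blocks c zero    f = cong (λ N → ∑ N f) (*-zeroʳ c)
∑-blocks c (suc M) f = begin
  ∑ (c * suc M) f                                   ≡⟨ cong (λ N → ∑ N f) (*-suc c M) ⟩
  ∑ (c + c * M) f                                   ≡⟨ ∑-+ c (c * M) f ⟩
  ∑ c f + (∑[ i < c * M ] f (c + i))                ≡⟨ cong (∑ c f +_) (∑-blocks c M (λ i → f (c + i))) ⟩
  ∑ c f + (∑[ y < M ] ∑[ a < c ] f (c + (y * c + a)))
    ≡⟨ cong (∑ c f +_) (∑-cong M (λ y _ → ∑-cong c (λ a _ → cong f (sym (+-assoc c (y * c) a))))) ⟩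
  (∑[ y < suc M ] ∑[ a < c ] f (y * c + a))         ∎
  where open ≡-Reasoning

sum-applyUpTo : ∀ n f → sum (applyUpTo f n) ≡ ∑ n f
sum-applyUpTo zero    f = refl
sum-applyUpTo (suc n) f = cong (f 0 +_) (sum-applyUpTo n (f ∘ suc))

sum-map-upTo : ∀ n f → sum (map f (upTo n)) ≡ ∑ n f
sum-map-upTo n f = trans (cong sum (map-upTo f n)) (sum-applyUpTo n f)

∏ : (t : ℕ) → (Fin t → ℕ) → ℕ
∏ zero    f = 1
∏ (suc t) f = f fzero * ∏ t (f ∘ fsuc)

∏-cong : ∀ t {f g : Fin t → ℕ} → (∀ j → f j ≡ g j) → ∏ t f ≡ ∏ t g
∏-cong zero    eq = refl
∏-cong (suc t) eq = cong₂ _*_ (eq fzero) (∏-cong t (eq ∘ fsuc))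

∏≡0 : ∀ t (f : Fin t → ℕ) j → f j ≡ 0 → ∏ t f ≡ 0
∏≡0 (suc t) f fzero    fj≡0 = cong (_* ∏ t (f ∘ fsuc)) fj≡0
∏≡0 (suc t) f (fsuc j) fj≡0 = trans (cong (f fzero *_) (∏≡0 t (f ∘ fsuc) j fj≡0)) (*-zeroʳ (f fzero))

∏≡1 : ∀ t (f : Fin t → ℕ) → (∀ j → f j ≡ 1) → ∏ t f ≡ 1
∏≡1 zero    f f≡1 = refl
∏≡1 (suc t) f f≡1 = cong₂ _*_ (f≡1 fzero) (∏≡1 t (f ∘ fsuc) (f≡1 ∘ fsuc))

product-tabulate : ∀ t (f : Fin t → ℕ) → product (tabulate f) ≡ ∏ t f
product-tabulate zero    f = refl
product-tabulate (suc t) f = cong (f fzero *_) (product-tabulate t (f ∘ fsuc))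

product-map-allFin : ∀ t (f : Fin t → ℕ) → product (map f (allFin t)) ≡ ∏ t f
product-map-allFin t f = trans (cong product (map-tabulate (λ j → j) f)) (product-tabulate t f)

-- coefficients of xᵃ · h, for h a coefficient sequence
shift : (ℕ → ℕ) → ℕ → ℕ → ℕ
shift h zero    k       = h k
shift h (suc a) zero    = 0
shift h (suc a) (suc k) = shift h a k

shift-≤ : ∀ h {a k} → a ≤ k → shift h a k ≡ h (k ∸ a)
shift-≤ h {zero}           _         = refl
shift-≤ h {suc a} {suc k} (s≤s a≤k) = shift-≤ h a≤k

shift-> : ∀ h {a k} → k < a → shift h a k ≡ 0
shift-> h {suc a} {zero}  _         = refl
shift-> h {suc a} {suc k} (s<s k<a) = shift-> h k<a

coeff-polyAdd : ∀ xs ys i → coeff (polyAdd xs ys) i ≡ coeff xs i + coeff ys i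
coeff-polyAdd []       ys       i       = refl
coeff-polyAdd (x ∷ xs) []       i       = sym (+-identityʳ _)
coeff-polyAdd (x ∷ xs) (y ∷ ys) zero    = refl
coeff-polyAdd (x ∷ xs) (y ∷ ys) (suc i) = coeff-polyAdd xs ys i

coeff-polyMul-ones : ∀ c g k → coeff (polyMul (L.replicate c 1) g) k ≡ (∑[ a < c ] shift (coeff g) a k)
coeff-polyMul-ones zero    g k = refl
coeff-polyMul-ones (suc c) g k = begin
  coeff (polyAdd (map (1 *_) g) (0 ∷ polyMul (L.replicate c 1) g)) k
    ≡⟨ coeff-polyAdd (map (1 *_) g) _ k ⟩
  coeff (map (1 *_) g) k + coeff (0 ∷ polyMul (L.replicate c 1) g) k
    ≡⟨ cong₂ _+_ (cong (λ h → coeff h k) (trans (map-cong *-identityˡ g) (map-id g))) (shifted k) ⟩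
  coeff g k + (∑[ a < c ] shift (coeff g) (suc a) k) ∎
  where
  open ≡-Reasoning
  shifted : ∀ k → coeff (0 ∷ polyMul (L.replicate c 1) g) k ≡ (∑[ a < c ] shift (coeff g) (suc a) k)
  shifted zero    = sym (∑-0 c)
  shifted (suc k) = coeff-polyMul-ones c g k

module _ {a ℓ : Level} {A B : Set a} {P : Pred A ℓ} (P? : Decidable P) where

  length-filter-concatMap : (f : B → List A) (xs : List B) →
    length (filter P? (concatMap f xs)) ≡ sum (map (length ∘ filter P? ∘ f) xs)
  length-filter-concatMap f []       = refl
  length-filter-concatMap f (x ∷ xs) = begin
    length (filter P? (f x L.++ concatMap f xs))               ≡⟨ cong length (filter-++ P? (f x) (concatMap f xs)) ⟩
    length (filter P? (f x) L.++ filter P? (concatMap f xs))   ≡⟨ length-++ (filter P? (f x)) ⟩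
    length (filter P? (f x)) + length (filter P? (concatMap f xs))
      ≡⟨ cong (length (filter P? (f x)) +_) (length-filter-concatMap f xs) ⟩
    sum (map (length ∘ filter P? ∘ f) (x ∷ xs))                ∎
    where open ≡-Reasoning

  length-filter-map : (f : B → A) (xs : List B) → length (filter P? (map f xs)) ≡ length (filter (P? ∘ f) xs)
  length-filter-map f []       = refl
  length-filter-map f (x ∷ xs) with P? (f x)
  ... | yes _ = cong suc (length-filter-map f xs)
  ... | no  _ = length-filter-map f xs

module _ {a ℓ : Level} {A : Set a} {P Q : Pred A ℓ} (P? : Decidable P) (Q? : Decidable Q) where

  filter-cong-All : ∀ {xs} → All (λ x → P x ⇔ Q x) xs → filter P? xs ≡ filter Q? xs
  filter-cong-All []                    = refl
  filter-cong-All {x ∷ xs} (P⇔Q ∷ rest) with P? x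
  ... | yes px = trans (cong (x ∷_) (filter-cong-All rest)) (sym (filter-accept Q? (Equivalence.to P⇔Q px)))
  ... | no ¬px = trans (filter-cong-All rest) (sym (filter-reject Q? (¬px ∘ Equivalence.from P⇔Q)))

∀-toℕ⇒∀-< : ∀ {t} {P : ℕ → Set} → (∀ (j : Fin t) → P (toℕ j)) → ∀ j → j < t → P j
∀-toℕ⇒∀-< {P = P} h j j<t = subst P (toℕ-fromℕ< j<t) (h (fromℕ< j<t))

allVecs-< : ∀ k m → All (Allᵥ.All (_< k)) (allVecs k m)
allVecs-< k zero    = Allᵥ.[] ∷ []
allVecs-< k (suc m) = concat⁺ (map⁺ (All.map (λ x<k → map⁺ (All.map (x<k Allᵥ.∷_) (allVecs-< k m))) (all-upTo k)))

sum-replicate : ∀ m c → V.sum (replicate m c) ≡ m * c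
sum-replicate zero    c = refl
sum-replicate (suc m) c = cong (c +_) (sum-replicate m c)

m+[n∸1]*m≡n*m : ∀ n m .{{_ : NonZero n}} → m + (n ∸ 1) * m ≡ n * m
m+[n∸1]*m≡n*m (suc n) m = refl

a*x+y≡a*y+x⇒x≡y : ∀ a x y → 2 ≤ a → a * x + y ≡ a * y + x → x ≡ y
a*x+y≡a*y+x⇒x≡y (suc zero)    x y (s≤s ()) _
a*x+y≡a*y+x⇒x≡y (suc (suc a)) x y _        eq =
  *-cancelˡ-≡ x y (suc a) (+-cancelʳ-≡ (x + y) (suc a * x) (suc a * y) (begin
  suc a * x + (x + y) ≡⟨ solve 3 (λ a x y → (con 1 :+ a) :* x :+ (x :+ y) := (con 2 :+ a) :* x :+ y) refl a x y ⟩
  suc (suc a) * x + y ≡⟨ eq ⟩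
  suc (suc a) * y + x ≡⟨ solve 3 (λ a x y → (con 2 :+ a) :* y :+ x := (con 1 :+ a) :* y :+ (x :+ y)) refl a x y ⟩
  suc a * y + (x + y) ∎))
  where open ≡-Reasoning

cyclic-balance : ∀ {c t} {X Y : ℕ → ℕ} →
  (∀ i → i < t → c * X (suc i) + Y i ≡ c * Y (suc i) + X i) →
  ∀ d i → i + d ≤ t → c ^ d * X (i + d) + Y i ≡ c ^ d * Y (i + d) + X i
cyclic-balance {c} {X = X} {Y} step zero i _ rewrite +-identityʳ i =
  solve 2 (λ x y → con 1 :* x :+ y := con 1 :* y :+ x) refl (X i) (Y i)
cyclic-balance {c} {X = X} {Y} step (suc d) i i+d<t rewrite +-suc i d =
  +-cancelʳ-≡ (cᵈ * Y (i + d)) _ _ (begin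
  c * cᵈ * X (suc (i + d)) + Y i + cᵈ * Y (i + d)
    ≡⟨ solve 5 (λ c e x' y z → c :* e :* x' :+ y :+ e :* z := e :* (c :* x' :+ z) :+ y) refl
               c cᵈ (X (suc (i + d))) (Y i) (Y (i + d)) ⟩
  cᵈ * (c * X (suc (i + d)) + Y (i + d)) + Y i
    ≡⟨ cong (λ z → cᵈ * z + Y i) (step (i + d) i+d<t) ⟩
  cᵈ * (c * Y (suc (i + d)) + X (i + d)) + Y i
    ≡⟨ solve 5 (λ c e y' x z → e :* (c :* y' :+ x) :+ z := c :* e :* y' :+ (e :* x :+ z)) refl
               c cᵈ (Y (suc (i + d))) (X (i + d)) (Y i) ⟩
  c * cᵈ * Y (suc (i + d)) + (cᵈ * X (i + d) + Y i)
    ≡⟨ cong (c * cᵈ * Y (suc (i + d)) +_) (cyclic-balance step d i (<⇒≤ i+d<t)) ⟩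
  c * cᵈ * Y (suc (i + d)) + (cᵈ * Y (i + d) + X i)
    ≡⟨ solve 3 (λ a b x → a :+ (b :+ x) := a :+ x :+ b) refl (c * cᵈ * Y (suc (i + d))) (cᵈ * Y (i + d)) (X i) ⟩
  c * cᵈ * Y (suc (i + d)) + X i + cᵈ * Y (i + d) ∎)
  where
  open ≡-Reasoning
  cᵈ = c ^ d

-- Going once around the cycle gives cᵗ X₀ + Y₀ = cᵗ Y₀ + X₀, which forces X₀ = Y₀ as cᵗ ≥ 2.
cyclic-recurrence-unique : ∀ {c t} {X Y K : ℕ → ℕ} → 2 ≤ c → 1 ≤ t →
  (∀ j → j < t → c * X (suc j) ≡ X j + K j) →
  (∀ j → j < t → c * Y (suc j) ≡ Y j + K j) →
  X t ≡ X 0 → Y t ≡ Y 0 → ∀ j → j ≤ t → X j ≡ Y j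
cyclic-recurrence-unique {c} {t} {X} {Y} {K} 2≤c 1≤t X-rec Y-rec Xₜ≡X₀ Yₜ≡Y₀ j j≤t =
  sym (+-cancelˡ-≡ (c ^ (t ∸ j) * Y t) (Y j) (X j) (begin
    c ^ (t ∸ j) * Y t + Y j ≡⟨ cong (λ z → c ^ (t ∸ j) * z + Y j) (sym Xₜ≡Yₜ) ⟩
    c ^ (t ∸ j) * X t + Y j ≡⟨ subst (λ m → c ^ (t ∸ j) * X m + Y j ≡ c ^ (t ∸ j) * Y m + X j) (m+[n∸m]≡n j≤t)
                                     (balance (t ∸ j) j (≤-reflexive (m+[n∸m]≡n j≤t))) ⟩
    c ^ (t ∸ j) * Y t + X j ∎))
  where
  open ≡-Reasoning
  balance : ∀ d i → i + d ≤ t → c ^ d * X (i + d) + Y i ≡ c ^ d * Y (i + d) + X i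
  balance = cyclic-balance λ i i<t → begin
    c * X (suc i) + Y i ≡⟨ cong (_+ Y i) (X-rec i i<t) ⟩
    X i + K i + Y i     ≡⟨ solve 3 (λ x k y → x :+ k :+ y := y :+ k :+ x) refl (X i) (K i) (Y i) ⟩
    Y i + K i + X i     ≡⟨ cong (_+ X i) (sym (Y-rec i i<t)) ⟩
    c * Y (suc i) + X i ∎
  2≤cᵗ : 2 ≤ c ^ t
  2≤cᵗ = ≤-trans 2≤c (≤-trans (≤-reflexive (sym (*-identityʳ c))) (^-monoʳ-≤ c 1≤t))
    where instance _ = >-nonZero (≤-trans (s≤s z≤n) 2≤c)
  Xₜ≡Yₜ : X t ≡ Y t
  Xₜ≡Yₜ = trans Xₜ≡X₀ (trans X₀≡Y₀ (sym Yₜ≡Y₀))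
    where
    X₀≡Y₀ : X 0 ≡ Y 0
    X₀≡Y₀ = a*x+y≡a*y+x⇒x≡y (c ^ t) (X 0) (Y 0) 2≤cᵗ
      (subst₂ (λ x y → c ^ t * x + Y 0 ≡ c ^ t * y + X 0) Xₜ≡X₀ Yₜ≡Y₀ (balance t 0 ≤-refl))

-- The base is suc k so that digit, which matches on its base, computes.
module Radix (k : ℕ) where

  p : ℕ
  p = suc k

  digit-zero : ∀ x → digit p x 0 ≡ x % p
  digit-zero x = cong (_% p) (n/1≡n x)

  digit-suc : ∀ x ℓ → digit p x (suc ℓ) ≡ digit p (x / p) ℓ
  digit-suc x ℓ = cong (_% p) (sym (m/n/o≡m/[n*o] x p (p ^ ℓ) {{_}} {{m^n≢0 p ℓ}} {{m^n≢0 p (suc ℓ)}}))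

  digit-zero-affine : ∀ y a → a < p → digit p (y * p + a) 0 ≡ a
  digit-zero-affine y a a<p = begin
    digit p (y * p + a) 0 ≡⟨ digit-zero (y * p + a) ⟩
    (y * p + a) % p       ≡⟨ %-remove-+ˡ a (n∣m*n y) ⟩
    a % p                 ≡⟨ m<n⇒m%n≡m a<p ⟩
    a                     ∎
    where open ≡-Reasoning

  quotient-affine : ∀ y a → a < p → (y * p + a) / p ≡ y
  quotient-affine y a a<p = begin
    (y * p + a) / p   ≡⟨ +-distrib-/-∣ˡ a (n∣m*n y) ⟩
    y * p / p + a / p ≡⟨ cong₂ _+_ (m*n/n≡m y p) (m<n⇒m/n≡0 a<p) ⟩
    y + 0             ≡⟨ +-identityʳ y ⟩
    y                 ∎
    where open ≡-Reasoning

  ∑-∏-digits : ∀ t (G : Fin t → ℕ → ℕ) →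
    (∑[ x < p ^ t ] ∏ t (λ j → G j (digit p x (toℕ j)))) ≡ ∏ t (λ j → ∑ p (G j))
  ∑-∏-digits zero    G = refl
  ∑-∏-digits (suc t) G = begin
    ∑ (p * p ^ t) F                                  ≡⟨ ∑-blocks p (p ^ t) F ⟩
    (∑[ y < p ^ t ] ∑[ a < p ] F (y * p + a))        ≡⟨ ∑-cong (p ^ t) (λ y _ → ∑-cong p (λ a a<p → F-affine y a a<p)) ⟩
    (∑[ y < p ^ t ] ∑[ a < p ] G fzero a * H y)      ≡⟨ ∑-cong (p ^ t) (λ y _ → sym (*-distribʳ-∑ (H y) p (G fzero))) ⟩
    (∑[ y < p ^ t ] ∑ p (G fzero) * H y)             ≡⟨ sym (*-distribˡ-∑ (∑ p (G fzero)) (p ^ t) H) ⟩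
    ∑ p (G fzero) * ∑ (p ^ t) H                      ≡⟨ cong (∑ p (G fzero) *_) (∑-∏-digits t (G ∘ fsuc)) ⟩
    ∏ (suc t) (λ j → ∑ p (G j))                      ∎
    where
    open ≡-Reasoning
    F H : ℕ → ℕ
    F x = ∏ (suc t) (λ j → G j (digit p x (toℕ j)))
    H y = ∏ t (λ j → G (fsuc j) (digit p y (toℕ j)))
    F-affine : ∀ y a → a < p → F (y * p + a) ≡ G fzero a * H y
    F-affine y a a<p = cong₂ _*_ (cong (G fzero) (digit-zero-affine y a a<p)) (∏-cong t (λ j → cong (G (fsuc j))
      (trans (digit-suc (y * p + a) (toℕ j)) (cong (λ z → digit p z (toℕ j)) (quotient-affine y a a<p)))))

  digit-expansion : ∀ t x → x < p ^ t → (∑[ ℓ < t ] p ^ ℓ * digit p x ℓ) ≡ x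
  digit-expansion zero    zero    _        = refl
  digit-expansion zero    (suc x) (s≤s ())
  digit-expansion (suc t) x       x<p^1+t = begin
    (∑[ ℓ < suc t ] p ^ ℓ * digit p x ℓ)
      ≡⟨ cong₂ _+_ (trans (*-identityˡ _) (digit-zero x))
                   (∑-cong t (λ ℓ _ → trans (*-assoc p (p ^ ℓ) _) (cong (λ d → p * (p ^ ℓ * d)) (digit-suc x ℓ)))) ⟩
    x % p + (∑[ ℓ < t ] p * (p ^ ℓ * digit p (x / p) ℓ)) ≡⟨ cong (x % p +_) (sym (*-distribˡ-∑ p t _)) ⟩
    x % p + p * (∑[ ℓ < t ] p ^ ℓ * digit p (x / p) ℓ)
      ≡⟨ cong (λ v → x % p + p * v) (digit-expansion t (x / p) (m<n*o⇒m/o<n (subst (x <_) (*-comm p (p ^ t)) x<p^1+t))) ⟩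
    x % p + p * (x / p)                                  ≡⟨ cong (x % p +_) (*-comm p (x / p)) ⟩
    x % p + x / p * p                                    ≡⟨ sym (m≡m%n+[m/n]*n x p) ⟩
    x                                                    ∎
    where open ≡-Reasoning

  rotHead rotTail : (t j x : ℕ) → ℕ
  rotHead t j x = ∑[ ℓ < j ] p ^ (ℓ + t ∸ j) * digit p x ℓ
  rotTail t j x = ∑[ i < t ∸ j ] p ^ i * digit p x (j + i)

  rotTerm-split : ∀ t j x → rotTerm p t j x ≡ rotHead t j x + rotTail t j x
  rotTerm-split t j x = cong₂ _+_ (sum-map-upTo j _) (begin
    sum (map (λ ℓ → p ^ (ℓ ∸ j) * digit p x ℓ) (map (j +_) (upTo (t ∸ j))))
      ≡⟨ cong sum (sym (map-∘ (upTo (t ∸ j)))) ⟩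
    sum (map (λ i → p ^ (j + i ∸ j) * digit p x (j + i)) (upTo (t ∸ j)))
      ≡⟨ sum-map-upTo (t ∸ j) _ ⟩
    (∑[ i < t ∸ j ] p ^ (j + i ∸ j) * digit p x (j + i))
      ≡⟨ ∑-cong (t ∸ j) (λ i _ → cong (λ e → p ^ e * digit p x (j + i)) (m+n∸m≡n j i)) ⟩
    rotTail t j x ∎)
    where open ≡-Reasoning

  rotHead-suc : ∀ t j x → j < t → p * rotHead t (suc j) x ≡ rotHead t j x + p ^ t * digit p x j
  rotHead-suc t j x j<t = begin
    p * rotHead t (suc j) x
      ≡⟨ cong (p *_) (∑-last j (λ ℓ → p ^ (ℓ + t ∸ suc j) * a ℓ)) ⟩
    p * ((∑[ ℓ < j ] p ^ (ℓ + t ∸ suc j) * a ℓ) + p ^ (j + t ∸ suc j) * a j)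
      ≡⟨ *-distribˡ-+ p (∑[ ℓ < j ] p ^ (ℓ + t ∸ suc j) * a ℓ) (p ^ (j + t ∸ suc j) * a j) ⟩
    p * (∑[ ℓ < j ] p ^ (ℓ + t ∸ suc j) * a ℓ) + p * (p ^ (j + t ∸ suc j) * a j)
      ≡⟨ cong₂ _+_ (trans (*-distribˡ-∑ p j (λ ℓ → p ^ (ℓ + t ∸ suc j) * a ℓ))
                          (∑-cong j (λ ℓ _ → raise (ℓ + t) (≤-trans j<t (m≤n+m t ℓ)))))
                   (trans (raise (j + t) (≤-trans j<t (m≤n+m t j))) (cong (λ e → p ^ e * a j) (m+n∸m≡n j t))) ⟩
    rotHead t j x + p ^ t * a j ∎
    where
    open ≡-Reasoning
    a = digit p x
    raise : ∀ m {d} → j < m → p * (p ^ (m ∸ suc j) * d) ≡ p ^ (m ∸ j) * d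
    raise m {d} j<m = trans (sym (*-assoc p (p ^ (m ∸ suc j)) d)) (cong (λ e → p ^ e * d) (sym (+-∸-assoc 1 j<m)))

  rotTail-suc : ∀ t j x → j < t → rotTail t j x ≡ digit p x j + p * rotTail t (suc j) x
  rotTail-suc t j x j<t = begin
    (∑[ i < t ∸ j ] p ^ i * a (j + i))
      ≡⟨ cong (λ n → ∑[ i < n ] p ^ i * a (j + i)) (+-∸-assoc 1 j<t) ⟩
    (∑[ i < suc (t ∸ suc j) ] p ^ i * a (j + i))
      ≡⟨ cong₂ _+_ (trans (*-identityˡ _) (cong a (+-identityʳ j)))
                   (∑-cong (t ∸ suc j) (λ i _ → trans (*-assoc p (p ^ i) _) (cong (λ m → p * (p ^ i * a m)) (+-suc j i)))) ⟩
    a j + (∑[ i < t ∸ suc j ] p * (p ^ i * a (suc j + i)))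
      ≡⟨ cong (a j +_) (sym (*-distribˡ-∑ p (t ∸ suc j) (λ i → p ^ i * a (suc j + i)))) ⟩
    a j + p * rotTail t (suc j) x ∎
    where
    open ≡-Reasoning
    a = digit p x

  rotTerm-suc : ∀ t j x → j < t → p * rotTerm p t (suc j) x ≡ rotTerm p t j x + (p ^ t ∸ 1) * digit p x j
  rotTerm-suc t j x j<t = begin
    p * rotTerm p t (suc j) x                   ≡⟨ cong (p *_) (rotTerm-split t (suc j) x) ⟩
    p * (rotHead t (suc j) x + rotTail′)        ≡⟨ *-distribˡ-+ p _ rotTail′ ⟩
    p * rotHead t (suc j) x + p * rotTail′      ≡⟨ cong (_+ p * rotTail′) (rotHead-suc t j x j<t) ⟩
    rotHead t j x + p ^ t * a + p * rotTail′
      ≡⟨ cong (λ z → rotHead t j x + z + p * rotTail′) (sym (m+[n∸1]*m≡n*m (p ^ t) a {{m^n≢0 p t}})) ⟩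
    rotHead t j x + (a + P * a) + p * rotTail′
      ≡⟨ solve 4 (λ h a b c → h :+ (a :+ b) :+ c := h :+ (a :+ c) :+ b) refl (rotHead t j x) a (P * a) (p * rotTail′) ⟩
    rotHead t j x + (a + p * rotTail′) + P * a  ≡⟨ cong (λ z → rotHead t j x + z + P * a) (sym (rotTail-suc t j x j<t)) ⟩
    rotHead t j x + rotTail t j x + P * a       ≡⟨ cong (_+ P * a) (sym (rotTerm-split t j x)) ⟩
    rotTerm p t j x + P * a                     ∎
    where
    open ≡-Reasoning
    a = digit p x j
    P = p ^ t ∸ 1
    rotTail′ = rotTail t (suc j) x

  rotTerm-zero : ∀ t x → rotTerm p t 0 x ≡ (∑[ ℓ < t ] p ^ ℓ * digit p x ℓ)
  rotTerm-zero t x = rotTerm-split t 0 x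

  rotTerm-last : ∀ t x → rotTerm p t t x ≡ (∑[ ℓ < t ] p ^ ℓ * digit p x ℓ)
  rotTerm-last t x = begin
    rotTerm p t t x
      ≡⟨ rotTerm-split t t x ⟩
    rotHead t t x + rotTail t t x
      ≡⟨ cong₂ _+_ (∑-cong t (λ ℓ _ → cong (λ e → p ^ e * digit p x ℓ) (m+n∸n≡m ℓ t)))
                   (cong (λ n → ∑[ i < n ] p ^ i * digit p x (t + i)) (n∸n≡0 t)) ⟩
    (∑[ ℓ < t ] p ^ ℓ * digit p x ℓ) + 0
      ≡⟨ +-identityʳ _ ⟩
    (∑[ ℓ < t ] p ^ ℓ * digit p x ℓ) ∎
    where open ≡-Reasoning

  columnSum : ∀ {m} → ℕ → Vec ℕ m → ℕ
  columnSum j b = V.sum (V.map (λ x → digit p x j) b)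

  HasColumnSums : ∀ {t m} → (Fin t → ℕ) → Vec ℕ m → Set
  HasColumnSums L b = ∀ j → columnSum (toℕ j) b ≡ L j

  hasColumnSums? : ∀ {t m} (L : Fin t → ℕ) → Decidable (HasColumnSums {m = m} L)
  hasColumnSums? L b = all? (λ j → columnSum (toℕ j) b ≟ L j)

  onesPowCoeff : ℕ → ℕ → ℕ
  onesPowCoeff m = coeff (polyPow (L.replicate p 1) m)

  count-prepend : ∀ {t m} (vs : List (Vec ℕ m)) (N : ℕ → ℕ) →
    (∀ (L : Fin t → ℕ) → length (filter (hasColumnSums? L) vs) ≡ ∏ t (N ∘ L)) →
    ∀ x L → length (filter (hasColumnSums? L) (map (x ∷ᵥ_) vs)) ≡ ∏ t (λ j → shift N (digit p x (toℕ j)) (L j))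
  count-prepend {t} vs N count x L with all? (λ j → digit p x (toℕ j) ≤? L j)
  ... | yes x≤L = begin
    length (filter (hasColumnSums? L) (map (x ∷ᵥ_) vs)) ≡⟨ length-filter-map (hasColumnSums? L) (x ∷ᵥ_) vs ⟩
    length (filter (hasColumnSums? L ∘ (x ∷ᵥ_)) vs)
      ≡⟨ cong length (filter-≐ (hasColumnSums? L ∘ (x ∷ᵥ_)) (hasColumnSums? L′) ((λ {b} → peel b) , (λ {b} → unpeel b)) vs) ⟩
    length (filter (hasColumnSums? L′) vs)              ≡⟨ count L′ ⟩
    ∏ t (N ∘ L′)                                        ≡⟨ ∏-cong t (λ j → sym (shift-≤ N (x≤L j))) ⟩
    ∏ t (λ j → shift N (digit p x (toℕ j)) (L j))       ∎
    where
    open ≡-Reasoning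
    L′ : Fin t → ℕ
    L′ j = L j ∸ digit p x (toℕ j)
    peel : ∀ b → HasColumnSums L (x ∷ᵥ b) → HasColumnSums L′ b
    peel b eq j = sym (trans (cong (_∸ digit p x (toℕ j)) (sym (eq j))) (m+n∸m≡n (digit p x (toℕ j)) (columnSum (toℕ j) b)))
    unpeel : ∀ b → HasColumnSums L′ b → HasColumnSums L (x ∷ᵥ b)
    unpeel b eq j = trans (cong (digit p x (toℕ j) +_) (eq j)) (m+[n∸m]≡n (x≤L j))
  ... | no x≰L with ¬∀⟶∃¬ t _ (λ j → digit p x (toℕ j) ≤? L j) x≰L
  ... | j , xⱼ≰Lⱼ = begin
    length (filter (hasColumnSums? L) (map (x ∷ᵥ_) vs)) ≡⟨ length-filter-map (hasColumnSums? L) (x ∷ᵥ_) vs ⟩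
    length (filter (hasColumnSums? L ∘ (x ∷ᵥ_)) vs)
      ≡⟨ cong length (filter-none (hasColumnSums? L ∘ (x ∷ᵥ_)) (universal overshoots vs)) ⟩
    0                                                   ≡⟨ sym (∏≡0 t _ j (shift-> N (≰⇒> xⱼ≰Lⱼ))) ⟩
    ∏ t (λ j → shift N (digit p x (toℕ j)) (L j))       ∎
    where
    open ≡-Reasoning
    overshoots : ∀ b → ¬ HasColumnSums L (x ∷ᵥ b)
    overshoots b eq = xⱼ≰Lⱼ (subst (digit p x (toℕ j) ≤_) (eq j) (m≤m+n _ _))

  count-columnSums : ∀ t m (L : Fin t → ℕ) →
    length (filter (hasColumnSums? L) (allVecs (p ^ t) m)) ≡ ∏ t (λ j → onesPowCoeff m (L j))
  count-columnSums t zero L with hasColumnSums? L []ᵥ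
  ... | yes L≡0 = trans (cong length (filter-accept (hasColumnSums? L) L≡0))
                        (sym (∏≡1 t _ (λ j → cong (onesPowCoeff 0) (sym (L≡0 j)))))
  ... | no L≢0 with ¬∀⟶∃¬ t _ (λ j → 0 ≟ L j) L≢0
  ... | j , Lⱼ≢0 = trans (cong length (filter-reject (hasColumnSums? L) L≢0))
                         (sym (∏≡0 t _ j (onesPowCoeff-zero (L j) Lⱼ≢0)))
    where
    onesPowCoeff-zero : ∀ c → 0 ≢ c → onesPowCoeff 0 c ≡ 0
    onesPowCoeff-zero zero    0≢0 = ⊥-elim (0≢0 refl)
    onesPowCoeff-zero (suc c) _   = refl
  count-columnSums t (suc m) L = begin
    length (filter P? (concatMap (λ x → map (x ∷ᵥ_) vs) (upTo q)))
      ≡⟨ length-filter-concatMap P? (λ x → map (x ∷ᵥ_) vs) (upTo q) ⟩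
    sum (map (λ x → length (filter P? (map (x ∷ᵥ_) vs))) (upTo q))
      ≡⟨ sum-map-upTo q _ ⟩
    (∑[ x < q ] length (filter P? (map (x ∷ᵥ_) vs)))
      ≡⟨ ∑-cong q (λ x _ → count-prepend vs (onesPowCoeff m) (count-columnSums t m) x L) ⟩
    (∑[ x < q ] ∏ t (λ j → shift (onesPowCoeff m) (digit p x (toℕ j)) (L j)))
      ≡⟨ ∑-∏-digits t (λ j a → shift (onesPowCoeff m) a (L j)) ⟩
    ∏ t (λ j → ∑[ a < p ] shift (onesPowCoeff m) a (L j))
      ≡⟨ ∏-cong t (λ j → sym (coeff-polyMul-ones p (polyPow (L.replicate p 1) m) (L j))) ⟩
    ∏ t (λ j → onesPowCoeff (suc m) (L j)) ∎
    where
    open ≡-Reasoning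
    q = p ^ t
    vs = allVecs q m
    P? = hasColumnSums? L

module Types (k t′ : ℕ) where

  open Radix (suc k) public

  t q : ℕ
  t = suc t′
  q = p ^ t

  instance
    q∸1-nonZero : NonZero (q ∸ 1)
    q∸1-nonZero = >-nonZero (∸-monoˡ-≤ 1 (≤-trans (s≤s (s≤s z≤n)) (m≤m*n p (p ^ t′) {{m^n≢0 p t′}})))

  typeNum-suc : ∀ {m} (b : Vec ℕ m) j → j < t → p * typeNum p t (suc j) b ≡ typeNum p t j b + (q ∸ 1) * columnSum j b
  typeNum-suc []ᵥ       j _   = trans (*-zeroʳ p) (sym (*-zeroʳ (q ∸ 1)))
  typeNum-suc (x ∷ᵥ b) j j<t = begin
    p * (rotTerm p t (suc j) x + typeNum p t (suc j) b)
      ≡⟨ *-distribˡ-+ p (rotTerm p t (suc j) x) (typeNum p t (suc j) b) ⟩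
    p * rotTerm p t (suc j) x + p * typeNum p t (suc j) b
      ≡⟨ cong₂ _+_ (rotTerm-suc t j x j<t) (typeNum-suc b j j<t) ⟩
    (rotTerm p t j x + (q ∸ 1) * digit p x j) + (typeNum p t j b + (q ∸ 1) * columnSum j b)
      ≡⟨ solve 5 (λ r Q d T C → (r :+ Q :* d) :+ (T :+ Q :* C) := (r :+ T) :+ Q :* (d :+ C)) refl
               (rotTerm p t j x) (q ∸ 1) (digit p x j) (typeNum p t j b) (columnSum j b) ⟩
    typeNum p t j (x ∷ᵥ b) + (q ∸ 1) * columnSum j (x ∷ᵥ b) ∎
    where open ≡-Reasoning

  typeNum-last : ∀ {m} (b : Vec ℕ m) → typeNum p t t b ≡ typeNum p t 0 b
  typeNum-last b = cong V.sum (Vecₚ.map-cong (λ x → trans (rotTerm-last t x) (sym (rotTerm-zero t x))) b)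

  typeNum-zero : ∀ {m} (b : Vec ℕ m) → Allᵥ.All (_< q) b → typeNum p t 0 b ≡ V.sum b
  typeNum-zero []ᵥ       Allᵥ.[]           = refl
  typeNum-zero (x ∷ᵥ b) (x<q Allᵥ.∷ b<q) =
    cong₂ _+_ (trans (rotTerm-zero t x) (digit-expansion t x x<q)) (typeNum-zero b b<q)

  module _ (s : Fin t → ℕ) where

    -- s extended t-periodically; sₙ (suc (toℕ j)) is s (cyc j) by definition
    sₙ : ℕ → ℕ
    sₙ m = s (fromℕ< (m%n<n m t))

    sₙ-< : ∀ {m} (m<t : m < t) → sₙ m ≡ s (fromℕ< m<t)
    sₙ-< {m} m<t = cong s (fromℕ<-cong (m % t) m (m<n⇒m%n≡m m<t) (m%n<n m t) m<t)

    sₙ-toℕ : ∀ j → sₙ (toℕ j) ≡ s j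
    sₙ-toℕ j = trans (sₙ-< (toℕ<n j)) (cong s (fromℕ<-toℕ j (toℕ<n j)))

    sₙ-t : sₙ t ≡ sₙ 0
    sₙ-t = cong s (fromℕ<-cong (t % t) 0 (n%n≡0 t) (m%n<n t t) z<s)

    hasTypeₙ : ∀ {m} (b : Vec ℕ m) → HasType p t b s → ∀ i → i ≤ t → sₙ i * (q ∸ 1) ≡ typeNum p t i b
    hasTypeₙ b ht i i≤t with m≤n⇒m<n∨m≡n i≤t
    ... | inj₁ i<t = trans (cong (_* (q ∸ 1)) (sₙ-< i<t))
                           (trans (ht (fromℕ< i<t)) (cong (λ j → typeNum p t j b) (toℕ-fromℕ< i<t)))
    ... | inj₂ refl = trans (cong (_* (q ∸ 1)) sₙ-t) (trans (ht fzero) (sym (typeNum-last b)))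

    hasType⇒columnSums : ∀ {m} (b : Vec ℕ m) → HasType p t b s → HasColumnSums (lam p t s) b
    hasType⇒columnSums b ht j = sym (trans (cong (_∸ s j) p·sⱼ₊₁≡sⱼ+C) (m+n∸m≡n (s j) C))
      where
      open ≡-Reasoning
      i = toℕ j
      C = columnSum i b
      p·sⱼ₊₁≡sⱼ+C : p * sₙ (suc i) ≡ s j + C
      p·sⱼ₊₁≡sⱼ+C = *-cancelʳ-≡ _ _ (q ∸ 1) (begin
        p * sₙ (suc i) * (q ∸ 1)             ≡⟨ *-assoc p (sₙ (suc i)) (q ∸ 1) ⟩
        p * (sₙ (suc i) * (q ∸ 1))           ≡⟨ cong (p *_) (hasTypeₙ b ht (suc i) (toℕ<n j)) ⟩
        p * typeNum p t (suc i) b            ≡⟨ typeNum-suc b i (toℕ<n j) ⟩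
        typeNum p t i b + (q ∸ 1) * C        ≡⟨ cong₂ _+_ (sym (ht j)) (*-comm (q ∸ 1) C) ⟩
        s j * (q ∸ 1) + C * (q ∸ 1)          ≡⟨ sym (*-distribʳ-+ (q ∸ 1) (s j) C) ⟩
        (s j + C) * (q ∸ 1)                  ∎)

    columnSums⇒hasType : (∀ j → s j ≤ p * s (cyc j)) →
      ∀ {m} (b : Vec ℕ m) → HasColumnSums (lam p t s) b → HasType p t b s
    columnSums⇒hasType s≤ps b cs j = begin
      s j * (q ∸ 1)            ≡⟨ cong (_* (q ∸ 1)) (sym (sₙ-toℕ j)) ⟩
      sₙ (toℕ j) * (q ∸ 1)     ≡⟨ sym (T≡Y (toℕ j) (<⇒≤ (toℕ<n j))) ⟩
      typeNum p t (toℕ j) b    ∎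
      where
      open ≡-Reasoning
      Y-rec : ∀ (j : Fin t) → p * (sₙ (suc (toℕ j)) * (q ∸ 1)) ≡ sₙ (toℕ j) * (q ∸ 1) + (q ∸ 1) * columnSum (toℕ j) b
      Y-rec j = begin
        p * (s (cyc j) * (q ∸ 1))                  ≡⟨ sym (*-assoc p (s (cyc j)) (q ∸ 1)) ⟩
        p * s (cyc j) * (q ∸ 1)                    ≡⟨ cong (_* (q ∸ 1)) (sym (m+[n∸m]≡n (s≤ps j))) ⟩
        (s j + lam p t s j) * (q ∸ 1)              ≡⟨ *-distribʳ-+ (q ∸ 1) (s j) (lam p t s j) ⟩
        s j * (q ∸ 1) + lam p t s j * (q ∸ 1)      ≡⟨ cong₂ _+_ (cong (_* (q ∸ 1)) (sym (sₙ-toℕ j)))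
                                                               (trans (*-comm _ (q ∸ 1)) (cong ((q ∸ 1) *_) (sym (cs j)))) ⟩
        sₙ (toℕ j) * (q ∸ 1) + (q ∸ 1) * columnSum (toℕ j) b ∎
      T≡Y : ∀ i → i ≤ t → typeNum p t i b ≡ sₙ i * (q ∸ 1)
      T≡Y = cyclic-recurrence-unique {p} {t} {λ i → typeNum p t i b} {λ i → sₙ i * (q ∸ 1)} {λ i → (q ∸ 1) * columnSum i b}
        (s≤s (s≤s z≤n)) (s≤s z≤n) (typeNum-suc b) (∀-toℕ⇒∀-< Y-rec) (typeNum-last b) (cong (_* (q ∸ 1)) sₙ-t)

    hasType⇒InMnc : 1 ≤ s fzero → ∀ {n} → s fzero ≤ n → (b : Vec ℕ (suc n)) →
      Allᵥ.All (_< q) b → HasType p t b s → InMnc p t b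
    hasType⇒InMnc 1≤s₀ {n} s₀≤n b b<q ht = divides (s fzero) Σb≡s₀·[q∸1] , ≢full , ≢zero
      where
      Σb≡s₀·[q∸1] : V.sum b ≡ s fzero * (q ∸ 1)
      Σb≡s₀·[q∸1] = trans (sym (typeNum-zero b b<q)) (sym (ht fzero))
      ≢full : b ≢ replicate (suc n) (q ∸ 1)
      ≢full b≡full = ≤⇒≯ s₀≤n (≤-reflexive (*-cancelʳ-≡ (suc n) (s fzero) (q ∸ 1)
        (trans (sym (sum-replicate (suc n) (q ∸ 1))) (trans (cong V.sum (sym b≡full)) Σb≡s₀·[q∸1]))))
      ≢zero : b ≢ replicate (suc n) 0
      ≢zero b≡0 = ≤⇒≯ (≤-reflexive (*-cancelʳ-≡ (s fzero) 0 (q ∸ 1)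
        (trans (sym Σb≡s₀·[q∸1]) (trans (cong V.sum b≡0) (trans (sum-replicate (suc n) 0) (*-zeroʳ (suc n))))))) 1≤s₀

    type⇔columnSums : ∀ {n} → InH p t n s → (b : Vec ℕ (suc n)) → Allᵥ.All (_< q) b →
      (InMnc p t b × HasType p t b s) ⇔ HasColumnSums (lam p t s) b
    type⇔columnSums s∈H b b<q = mk⇔ (hasType⇒columnSums b ∘ proj₂) λ cs →
      let ht = columnSums⇒hasType (λ j → proj₁ (proj₂ (proj₂ (s∈H j)))) b cs
      in hasType⇒InMnc (proj₁ (s∈H fzero)) (proj₁ (proj₂ (s∈H fzero))) b b<q ht , ht

lemma3p2 : (p t n : ℕ) → Prime p → 1 ≤ t → 1 ≤ n →
    (s : Fin t → ℕ) → InH p t n s →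
    countType p t n s ≡ prodD p t n s
lemma3p2 0             _        _ (prime {{()}} _)
lemma3p2 1             _        _ (prime {{()}} _)
lemma3p2 (suc (suc k)) zero     _ _ ()
lemma3p2 (suc (suc k)) (suc t′) n _ _ _ s s∈H = begin
  countType p t n s
    ≡⟨ cong length (filter-cong-All (dec-InMnc-type p t s) (hasColumnSums? (lam p t s))
                                    (All.map (type⇔columnSums s s∈H _) (allVecs-< q (suc n)))) ⟩
  length (filter (hasColumnSums? (lam p t s)) (allVecs q (suc n))) ≡⟨ count-columnSums t (suc n) (lam p t s) ⟩
  ∏ t (λ j → dCoeff p n (lam p t s j))
    ≡⟨ sym (product-map-allFin t (λ j → dCoeff p n (lam p t s j))) ⟩
  prodD p t n s                                                   ∎
  where
  open Types k t′
  open ≡-Reasoning
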